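{- Let $H=(V,E)$ be a finite bipartite graph with no isolated vertices that is not a forest. (1) If $|E(H)|\le4$, then $H=K_{2,2}$ and $\min_{e\in E(H)}|S_1(e)|=|E(H)|-\frac{|V(H)|}{2}$. (2) If $|E(H)|\ge5$, then $\min_{e\in E(H)}|S_1(e)|<|E(H)|-\frac{|V(H)|}{2}$.
   Context: For an edge $e$, $S_1(e)$ is the set of edges different from $e$ sharing an endpoint with $e$. -}

module Defs where

open import Data.Nat using (ℕ; zero; suc; _+_; _*_; _≤_; _<_; _<ᵇ_; _⊓_)
open import Data.Bool using (Bool; true; false; _∧_; _∨_; not; if_then_else_)
open import Data.Fin using (Fin; toℕ; fromℕ; inject₁; _≟_)
import Data.Fin as F
open import Data.List using (List; []; _∷_; [_]; concatMap; allFin; length; filterᵇ; map)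
open import Data.Product using (_×_; _,_; Σ; ∃; proj₁; proj₂)
open import Relation.Binary.PropositionalEquality using (_≡_; _≢_)
open import Relation.Nullary.Decidable using (⌊_⌋)
open import Function.Bundles using (_↔_; Inverse)

record Graph : Set where
  field
    n     : ℕ
    adj   : Fin n → Fin n → Bool
    sym   : ∀ u v → adj u v ≡ adj v u
    irrefl : ∀ u → adj u u ≡ false
open Graph public

∣V∣ : Graph → ℕ
∣V∣ G = n G

Edge : Graph → Set
Edge G = Fin (n G) × Fin (n G)

-- E(G): each edge {i,j} listed once, as the pair (i , j) with i < j.
edges : (G : Graph) → List (Edge G)
edges G = concatMap (λ i → concatMap (λ j →
            if (toℕ i <ᵇ toℕ j) ∧ adj G i j then [ (i , j) ] else [])
            (allFin (n G))) (allFin (n G))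

∣E∣ : Graph → ℕ
∣E∣ G = length (edges G)

_==_ : ∀ {m} → Fin m → Fin m → Bool
a == b = ⌊ a ≟ b ⌋

sameEdge : ∀ {m} → Fin m × Fin m → Fin m × Fin m → Bool
sameEdge (a , b) (c , d) = (a == c) ∧ (b == d)

shareEndpoint : ∀ {m} → Fin m × Fin m → Fin m × Fin m → Bool
shareEndpoint (a , b) (c , d) = (a == c) ∨ (a == d) ∨ (b == c) ∨ (b == d)

S₁ : (G : Graph) → Edge G → List (Edge G)
S₁ G e = filterᵇ (λ f → not (sameEdge f e) ∧ shareEndpoint f e) (edges G)

-- minimum of a list of naturals (value on the empty list is irrelevant: 0)
minList : List ℕ → ℕ
minList [] = 0
minList (x ∷ []) = x
minList (x ∷ xs@(_ ∷ _)) = x ⊓ minList xs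

minS₁ : Graph → ℕ
minS₁ G = minList (map (λ e → length (S₁ G e)) (edges G))

Bipartite : Graph → Set
Bipartite G = Σ (Fin (n G) → Bool) λ c →
  ∀ u v → adj G u v ≡ true → c u ≢ c v

NoIsolatedVertices : Graph → Set
NoIsolatedVertices G = ∀ v → ∃ λ u → adj G v u ≡ true

-- A cycle of length k+3: closed walk w 0, …, w (k+3) = w 0 with
-- consecutive vertices adjacent and w 0, …, w (k+2) pairwise distinct.
record Cycle (G : Graph) : Set where
  field
    k      : ℕ
    w      : Fin (suc (3 + k)) → Fin (n G)
    closed : w (fromℕ (3 + k)) ≡ w F.zero
    step   : ∀ (i : Fin (3 + k)) → adj G (w (inject₁ i)) (w (F.suc i)) ≡ true
    distinct : ∀ (i j : Fin (3 + k)) → w (inject₁ i) ≡ w (inject₁ j) → i ≡ j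

IsForest : Graph → Set
IsForest G = Cycle G → Data.Empty.⊥
  where import Data.Empty

_≅_ : Graph → Graph → Set
G ≅ H = Σ (Fin (n G) ↔ Fin (n H)) λ σ →
  ∀ u v → adj G u v ≡ adj H (Inverse.to σ u) (Inverse.to σ v)

-- K_{2,2} on Fin 4: parts {0,2} and {1,3}
private
  par : Fin 4 → Bool
  par F.zero = false
  par (F.suc F.zero) = true
  par (F.suc (F.suc F.zero)) = false
  par (F.suc (F.suc (F.suc F.zero))) = true

  xor : Bool → Bool → Bool
  xor true b = not b
  xor false b = b

  xor-sym : ∀ a b → xor a b ≡ xor b a
  xor-sym true true = Relation.Binary.PropositionalEquality.refl
  xor-sym true false = Relation.Binary.PropositionalEquality.refl
  xor-sym false true = Relation.Binary.PropositionalEquality.refl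
  xor-sym false false = Relation.Binary.PropositionalEquality.refl

  xor-self : ∀ a → xor a a ≡ false
  xor-self true = Relation.Binary.PropositionalEquality.refl
  xor-self false = Relation.Binary.PropositionalEquality.refl

K₂₂ : Graph
K₂₂ = record
  { n = 4
  ; adj = λ u v → xor (par u) (par v)
  ; sym = λ u v → xor-sym (par u) (par v)
  ; irrefl = λ u → xor-self (par u)
  }

-- For an edge uv, S₁(uv) consists of the other edges at u and at v, and no edge other than uv
-- meets both, so |S₁(uv)| = d(u) + d(v) − 2.  Without isolated vertices the handshake lemma
-- reads 2|E| = |V| + T, where T = Σ_v (d(v) − 1) is the total excess, so (2) follows once some
-- edge uv has 2((d(u) − 1) + (d(v) − 1)) < T.  A cycle of a bipartite graph is even: it is either
-- a 4-cycle, which spans an induced K₂,₂, or it contains a path on six vertices.  Unless the graph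
-- is that K₂,₂ itself, both cases provide five distinct vertices carrying two disjoint edges plus a
-- fifth vertex of degree at least 2.  Their excesses sum to at most T, and the fifth one is
-- positive, so one of the two edges carries less than half of T.  The same five vertices have
-- degree sum at least 9, so |E| ≥ 5; hence a graph with at most four edges is K₂,₂, which is
-- 2-regular with |S₁(e)| = 2 for every edge.
module Submission where

open import Data.Bool using (Bool; true; false; _∧_; _∨_; not; if_then_else_; T?)
open import Data.Bool.Properties
  using (¬-not; not-involutive; ∧-identityʳ; ∧-zeroʳ; ∨-identityʳ; ∧-comm; ∨-comm; ∨-assoc)
import Data.Bool.Properties as Bool
open import Data.Empty using (⊥-elim)
open import Data.Fin using (Fin; zero; suc; toℕ; punchOut; _≟_; inject₁; _↑ˡ_)
open import Data.Fin.Patterns using (0F; 1F; 2F; 3F; 4F)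
open import Data.Fin.Permutation using (↔⇒≡)
open import Data.Fin.Properties
  using (toℕ-injective; suc-injective; 0≢1+n; inject₁-injective; ↑ˡ-injective; punchInᵢ≢i;
         punchIn-punchOut; punchOut-injective; any?; all?; ¬∀⟶∃¬)
open import Data.List using (List; []; _∷_; [_]; _++_; length; filterᵇ; concatMap; tabulate; allFin; map)
open import Data.List.Membership.Propositional using (_∈_)
open import Data.List.Membership.Propositional.Properties using (∈-concatMap⁺; ∈-concatMap⁻; ∈-allFin)
open import Data.List.Properties using (filter-++; length-++)
open import Data.List.Relation.Unary.Any as Any using (here; there)
open import Data.Nat using (ℕ; zero; suc; _+_; _*_; _∸_; _≤_; _<_; _<ᵇ_; _⊓_; z≤n; s≤s; s≤s⁻¹)
open import Data.Nat.Properties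
  using (+-*-semiring; +-identityʳ; +-comm; +-assoc; +-suc; *-identityʳ; *-distribˡ-+; ≤-refl; ≤-reflexive;
         ≤-trans; ≤-antisym; <-asym; <-cmp; ≮⇒≥; <⇒≱; _<?_; <ᵇ-reflects-<; m<m+n; m⊓n≤m; m⊓n≤n;
         ⊓-idem; m+n∸n≡m; m+[n∸m]≡n; +-mono-≤; +-monoˡ-≤; +-monoʳ-≤; +-monoˡ-<; *-monoʳ-≤;
         *-monoʳ-<; +-cancelʳ-≤; +-cancelˡ-<; *-cancelˡ-≡; *-cancelˡ-<; module ≤-Reasoning)
open import Data.Nat.Solver using (module +-*-Solver)
open import Data.Product using (_,_; _×_; proj₁; proj₂; ∃; ∃₂)
open import Data.Sum using (_⊎_; inj₁; inj₂; [_,_]′)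
open import Data.Vec.Functional as Vec using (removeAt)
open import Defs renaming (sym to adj-sym)
open import Function using (_∘_)
open import Function.Bundles using (Inverse; mk↔ₛ′)
open import Function.Definitions using (Injective)
open import Relation.Binary.Definitions using (tri<; tri≈; tri>)
open import Relation.Binary.PropositionalEquality hiding ([_])
open import Relation.Nullary using (¬_)
open import Relation.Nullary.Decidable
  using (Dec; yes; no; ¬?; _×-dec_; _→-dec_; from-yes; decidable-stable)
open import Relation.Nullary.Reflects using (ofʸ; ofⁿ)

open +-*-Solver using (solve; _:+_; _:=_; con)
open import Algebra.Properties.Semiring.Sum +-*-semiring
  using (sum; sum-syntax; sum-remove; sum-cong-≗; sum-replicate-zero; ∑-distrib-+; ∑-comm;
         ∑-permute; *-distribˡ-sum)

-- Finite sums

χ : Bool → ℕ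
χ true  = 1
χ false = 0

∑-const : ∀ n c → ∑[ _ < n ] c ≡ n * c
∑-const zero    c = refl
∑-const (suc n) c = cong (c +_) (∑-const n c)

∑-supported : ∀ {n} (x : Fin n) (f : Fin n → ℕ) → (∀ i → i ≢ x → f i ≡ 0) →
  ∑[ i < n ] f i ≡ f x
∑-supported {suc n} x f f≡0 = begin
  sum f                     ≡⟨ sum-remove {i = x} f ⟩
  f x + sum (removeAt f x)  ≡⟨ cong (f x +_) (sum-cong-≗ (λ j → f≡0 _ (punchInᵢ≢i x j))) ⟩
  f x + ∑[ _ < n ] 0        ≡⟨ cong (f x +_) (sum-replicate-zero n) ⟩
  f x + 0                   ≡⟨ +-identityʳ (f x) ⟩
  f x                       ∎
  where open ≡-Reasoning

∑-∘-injective-≤ : ∀ {m n} (ι : Fin m → Fin n) → Injective _≡_ _≡_ ι → (f : Fin n → ℕ) →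
  ∑[ i < m ] f (ι i) ≤ ∑[ v < n ] f v
∑-∘-injective-≤ {zero}          ι _     f = z≤n
∑-∘-injective-≤ {suc m} {zero}  ι _     f with () ← ι zero
∑-∘-injective-≤ {suc m} {suc n} ι ι-inj f = begin
  f ι₀ + ∑[ i < m ] f (ι (suc i))        ≡⟨ cong (f ι₀ +_) (sum-cong-≗ λ i →
                                              cong f (sym (punchIn-punchOut (ι₀≢ i)))) ⟩
  f ι₀ + ∑[ i < m ] removeAt f ι₀ (ι′ i)  ≤⟨ +-monoʳ-≤ (f ι₀) (∑-∘-injective-≤ ι′ ι′-inj (removeAt f ι₀)) ⟩
  f ι₀ + sum (removeAt f ι₀)              ≡⟨ sum-remove f ⟨
  sum f                                   ∎
  where
  open ≤-Reasoning
  ι₀ = ι zero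
  ι₀≢ : ∀ i → ι₀ ≢ ι (suc i)
  ι₀≢ i = 0≢1+n ∘ ι-inj
  ι′ : Fin m → Fin n
  ι′ i = punchOut (ι₀≢ i)
  ι′-inj : Injective _≡_ _≡_ ι′
  ι′-inj eq = suc-injective (ι-inj (punchOut-injective (ι₀≢ _) (ι₀≢ _) eq))

∑² : ∀ {n} → (Fin n → Fin n → ℕ) → ℕ
∑² {n} f = ∑[ i < n ] ∑[ j < n ] f i j

∑²-cong : ∀ {n} {f g : Fin n → Fin n → ℕ} → (∀ i j → f i j ≡ g i j) → ∑² f ≡ ∑² g
∑²-cong {n} f≡g = sum-cong-≗ {n} (λ i → sum-cong-≗ {n} (f≡g i))

∑²-distrib-+ : ∀ {n} (f g : Fin n → Fin n → ℕ) → ∑² (λ i j → f i j + g i j) ≡ ∑² f + ∑² g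
∑²-distrib-+ {n} f g = trans (sum-cong-≗ {n} λ i → ∑-distrib-+ (f i) (g i))
  (∑-distrib-+ (λ i → ∑[ j < n ] f i j) (λ i → ∑[ j < n ] g i j))

*-distribˡ-∑² : ∀ {n} c (f : Fin n → Fin n → ℕ) → c * ∑² f ≡ ∑² (λ i j → c * f i j)
*-distribˡ-∑² {n} c f = trans (*-distribˡ-sum c (λ i → ∑[ j < n ] f i j))
  (sum-cong-≗ {n} λ i → *-distribˡ-sum c (f i))

upper : ∀ {n} → (Fin n → Fin n → ℕ) → Fin n → Fin n → ℕ
upper f i j = if toℕ i <ᵇ toℕ j then f i j else 0

∑²-upper : ∀ {n} (f : Fin n → Fin n → ℕ) → (∀ i j → f i j ≡ f j i) → (∀ i → f i i ≡ 0) →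
  2 * ∑² (upper f) ≡ ∑² f
∑²-upper {n} f f-sym f-diag = begin
  2 * ∑² (upper f)                               ≡⟨ cong (∑² (upper f) +_) (+-identityʳ _) ⟩
  ∑² (upper f) + ∑² (upper f)                    ≡⟨ cong (∑² (upper f) +_) (∑-comm (λ i j → upper f j i)) ⟨
  ∑² (upper f) + ∑² (λ i j → upper f j i)        ≡⟨ ∑²-distrib-+ (upper f) (λ i j → upper f j i) ⟨
  ∑² (λ i j → upper f i j + upper f j i)         ≡⟨ ∑²-cong split ⟨
  ∑² f                                           ∎
  where
  open ≡-Reasoning
  split : ∀ i j → f i j ≡ upper f i j + upper f j i
  split i j with toℕ i <ᵇ toℕ j | <ᵇ-reflects-< (toℕ i) (toℕ j)
               | toℕ j <ᵇ toℕ i | <ᵇ-reflects-< (toℕ j) (toℕ i)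
  ... | true  | ofʸ i<j | true  | ofʸ j<i = ⊥-elim (<-asym i<j j<i)
  ... | true  | _       | false | _       = sym (+-identityʳ (f i j))
  ... | false | _       | true  | _       = f-sym i j
  ... | false | ofⁿ i≮j | false | ofⁿ j≮i
    rewrite toℕ-injective (≤-antisym (≮⇒≥ j≮i) (≮⇒≥ i≮j)) = f-diag j

==-refl : ∀ {m} (x : Fin m) → (x == x) ≡ true
==-refl x with x ≟ x
... | yes _   = refl
... | no x≢x = ⊥-elim (x≢x refl)

==-≢ : ∀ {m} {x y : Fin m} → x ≢ y → (x == y) ≡ false
==-≢ {x = x} {y} x≢y with x ≟ y
... | yes x≡y = ⊥-elim (x≢y x≡y)
... | no _    = refl

==-∧-==ˡ : ∀ {m} {x y : Fin m} → x ≢ y → ∀ z → (z == x) ∧ (z == y) ≡ false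
==-∧-==ˡ {x = x} {y} x≢y z with z ≟ x | z ≟ y
... | yes refl | yes refl = ⊥-elim (x≢y refl)
... | yes _    | no _     = refl
... | no _     | _        = refl

==-∧-==ʳ : ∀ {m} {x y : Fin m} → x ≢ y → ∀ z → (x == z) ∧ (y == z) ≡ false
==-∧-==ʳ {x = x} {y} x≢y z with x ≟ z | y ≟ z
... | yes refl | yes refl = ⊥-elim (x≢y refl)
... | yes _    | no _     = refl
... | no _     | _        = refl

∑-χ-∧-false : ∀ {n} (f : Fin n → Bool) → ∑[ j < n ] χ (f j ∧ false) ≡ 0
∑-χ-∧-false {n} f = trans (sum-cong-≗ {n} λ j → cong χ (∧-zeroʳ (f j))) (sum-replicate-zero n)

∑-χ-∧-== : ∀ {n} (f : Fin n → Bool) x → ∑[ j < n ] χ (f j ∧ (j == x)) ≡ χ (f x)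
∑-χ-∧-== f x = trans
  (∑-supported x _ λ j j≢x → trans (cong (λ b → χ (f j ∧ b)) (==-≢ j≢x)) (cong χ (∧-zeroʳ (f j))))
  (trans (cong (λ b → χ (f x ∧ b)) (==-refl x)) (cong χ (∧-identityʳ (f x))))

∑-==-outer : ∀ {n} x (F : Fin n → Bool → ℕ) → (∀ i → F i false ≡ 0) →
  ∑[ i < n ] F i (i == x) ≡ F x true
∑-==-outer x F F≡0 = trans (∑-supported x _ λ i i≢x → trans (cong (F i) (==-≢ i≢x)) (F≡0 i))
  (cong (F x) (==-refl x))

length-filterᵇ-concatMap : ∀ {A B : Set} {n} (P : B → Bool) (g : A → List B) (h : Fin n → A) →
  length (filterᵇ P (concatMap g (tabulate h))) ≡ ∑[ i < n ] length (filterᵇ P (g (h i)))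
length-filterᵇ-concatMap {n = zero}  P g h = refl
length-filterᵇ-concatMap {n = suc n} P g h = begin
  length (filterᵇ P (g (h zero) ++ rest))                   ≡⟨ cong length (filter-++ (T? ∘ P) (g (h zero)) rest) ⟩
  length (filterᵇ P (g (h zero)) ++ filterᵇ P rest)         ≡⟨ length-++ (filterᵇ P (g (h zero))) ⟩
  length (filterᵇ P (g (h zero))) + length (filterᵇ P rest) ≡⟨ cong (_ +_) (length-filterᵇ-concatMap P g (h ∘ suc)) ⟩
  ∑[ i < suc n ] length (filterᵇ P (g (h i)))               ∎
  where
  open ≡-Reasoning
  rest = concatMap g (tabulate (h ∘ suc))

length-filterᵇ-if : ∀ {A : Set} (P : A → Bool) b c (x : A) →
  length (filterᵇ P (if b ∧ c then [ x ] else [])) ≡ (if b then χ (c ∧ P x) else 0)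
length-filterᵇ-if P false c     x = refl
length-filterᵇ-if P true  false x = refl
length-filterᵇ-if P true  true  x with P x
... | true  = refl
... | false = refl

length-filterᵇ-true : ∀ {A : Set} (xs : List A) → length (filterᵇ (λ _ → true) xs) ≡ length xs
length-filterᵇ-true []       = refl
length-filterᵇ-true (x ∷ xs) = cong suc (length-filterᵇ-true xs)

minList-map-≤ : ∀ {A : Set} (f : A → ℕ) {x xs} → x ∈ xs → minList (map f xs) ≤ f x
minList-map-≤ f {xs = y ∷ []}     (here refl) = ≤-refl
minList-map-≤ f {xs = y ∷ _ ∷ _}  (here refl) = m⊓n≤m (f y) _
minList-map-≤ f {xs = y ∷ z ∷ zs} (there x∈)  = ≤-trans (m⊓n≤n (f y) _) (minList-map-≤ f x∈)

minList-map-const : ∀ {A : Set} (f : A → ℕ) c {x xs} → x ∈ xs → (∀ {y} → y ∈ xs → f y ≡ c) →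
  minList (map f xs) ≡ c
minList-map-const f c {xs = y ∷ []}     _ f≡c = f≡c (here refl)
minList-map-const f c {xs = y ∷ z ∷ zs} _ f≡c =
  trans (cong₂ _⊓_ (f≡c (here refl)) (minList-map-const f c (here refl) (f≡c ∘ there))) (⊓-idem c)

module _ (G : Graph) where

  private
    pair : Fin (n G) → Fin (n G) → List (Edge G)
    pair i j = if (toℕ i <ᵇ toℕ j) ∧ adj G i j then [ (i , j) ] else []

    row : Fin (n G) → List (Edge G)
    row i = concatMap (pair i) (allFin (n G))

  deg : Fin (n G) → ℕ
  deg v = ∑[ u < n G ] χ (adj G v u)

  adj⇒≢ : ∀ {x y} → adj G x y ≡ true → x ≢ y
  adj⇒≢ {x} xy refl with () ← trans (sym xy) (irrefl G x)

  count-edges : (P : Edge G → Bool) →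
    length (filterᵇ P (edges G)) ≡ ∑² (upper (λ i j → χ (adj G i j ∧ P (i , j))))
  count-edges P =
    trans (length-filterᵇ-concatMap P row (λ i → i)) (sum-cong-≗ {n G} λ i →
    trans (length-filterᵇ-concatMap P (pair i) (λ j → j)) (sum-cong-≗ {n G} λ j →
    length-filterᵇ-if P (toℕ i <ᵇ toℕ j) (adj G i j) (i , j)))

  count-edges-sym : (P : Edge G → Bool) → (∀ i j → P (i , j) ≡ P (j , i)) →
    2 * length (filterᵇ P (edges G)) ≡ ∑² (λ i j → χ (adj G i j ∧ P (i , j)))
  count-edges-sym P P-sym = trans (cong (2 *_) (count-edges P)) (∑²-upper _
    (λ i j → cong₂ (λ x y → χ (x ∧ y)) (adj-sym G i j) (P-sym i j))
    (λ i → cong (λ x → χ (x ∧ P (i , i))) (irrefl G i)))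

  handshake : ∑[ v < n G ] deg v ≡ 2 * ∣E∣ G
  handshake = begin
    ∑² (λ i j → χ (adj G i j))                    ≡⟨ ∑²-cong (λ i j → cong χ (∧-identityʳ (adj G i j))) ⟨
    ∑² (λ i j → χ (adj G i j ∧ true))             ≡⟨ count-edges-sym (λ _ → true) (λ _ _ → refl) ⟨
    2 * length (filterᵇ (λ _ → true) (edges G))   ≡⟨ cong (2 *_) (length-filterᵇ-true (edges G)) ⟩
    2 * ∣E∣ G                                     ∎
    where open ≡-Reasoning

  ∑²-row : ∀ x → ∑² (λ i j → χ (adj G i j ∧ (i == x))) ≡ deg x
  ∑²-row x = trans
    (∑-==-outer x (λ i b → ∑[ j < n G ] χ (adj G i j ∧ b)) (λ i → ∑-χ-∧-false (adj G i)))
    (sum-cong-≗ {n G} λ j → cong χ (∧-identityʳ (adj G x j)))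

  ∑²-column : ∀ x → ∑² (λ i j → χ (adj G i j ∧ (j == x))) ≡ deg x
  ∑²-column x = trans (sum-cong-≗ {n G} λ i → ∑-χ-∧-== (adj G i) x)
    (sum-cong-≗ {n G} λ i → cong χ (adj-sym G i x))

  ∑²-entry : ∀ x y → ∑² (λ i j → χ (adj G i j ∧ ((i == x) ∧ (j == y)))) ≡ χ (adj G x y)
  ∑²-entry x y = trans
    (∑-==-outer x (λ i b → ∑[ j < n G ] χ (adj G i j ∧ (b ∧ (j == y)))) (λ i → ∑-χ-∧-false (adj G i)))
    (∑-χ-∧-== (adj G x) y)

  ∈-edges⁺ : ∀ {u v} → toℕ u < toℕ v → adj G u v ≡ true → (u , v) ∈ edges G
  ∈-edges⁺ {u} {v} u<v uv =
    ∈-concatMap⁺ row (Any.map (λ { refl →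
    ∈-concatMap⁺ (pair u) (Any.map (λ { refl → u,v∈pair }) (∈-allFin v)) }) (∈-allFin u))
    where
    u,v∈pair : (u , v) ∈ pair u v
    u,v∈pair with toℕ u <ᵇ toℕ v | <ᵇ-reflects-< (toℕ u) (toℕ v)
    ... | true  | _       rewrite uv = here refl
    ... | false | ofⁿ u≮v = ⊥-elim (u≮v u<v)

  ∈-edges⁻ : ∀ {u v} → (u , v) ∈ edges G → toℕ u < toℕ v × adj G u v ≡ true
  ∈-edges⁻ {u} {v} uv∈ with Any.satisfied (∈-concatMap⁻ row {xs = allFin (n G)} uv∈)
  ... | i , uv∈row with Any.satisfied (∈-concatMap⁻ (pair i) {xs = allFin (n G)} uv∈row)
  ... | j , uv∈pair = from-pair uv∈pair
    where
    from-pair : (u , v) ∈ pair i j → toℕ u < toℕ v × adj G u v ≡ true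
    from-pair p with toℕ i <ᵇ toℕ j | <ᵇ-reflects-< (toℕ i) (toℕ j) | adj G i j in ij
    from-pair (here refl) | true | ofʸ i<j | true = i<j , ij

  adj⇒∈-edges : ∀ {x y} → adj G x y ≡ true → (x , y) ∈ edges G ⊎ (y , x) ∈ edges G
  adj⇒∈-edges {x} {y} xy with <-cmp (toℕ x) (toℕ y)
  ... | tri< x<y _ _ = inj₁ (∈-edges⁺ x<y xy)
  ... | tri≈ _ x≡y _ = ⊥-elim (adj⇒≢ xy (toℕ-injective x≡y))
  ... | tri> _ _ y<x = inj₂ (∈-edges⁺ y<x (trans (adj-sym G y x) xy))

-- The size of S₁(e)

-- The predicate defining S₁ made symmetric in the edge f, so that count-edges-sym applies;
-- the two agree on the pairs (i , j) with i < j listed in edges.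
neighbouring : ∀ {m} → Fin m × Fin m → Fin m × Fin m → Bool
neighbouring (u , v) f = not (sameEdge f (u , v) ∨ sameEdge f (v , u)) ∧ shareEndpoint f (u , v)

neighbouring-swap : ∀ {m} (e : Fin m × Fin m) i j → neighbouring e (i , j) ≡ neighbouring e (j , i)
neighbouring-swap (u , v) i j = cong₂ (λ p q → not p ∧ q)
  (trans (cong₂ _∨_ (∧-comm (i == u) (j == v)) (∧-comm (i == v) (j == u)))
         (∨-comm ((j == v) ∧ (i == u)) ((j == u) ∧ (i == v))))
  (trans (sym (∨-assoc (i == u) (i == v) ((j == u) ∨ (j == v))))
  (trans (∨-comm ((i == u) ∨ (i == v)) ((j == u) ∨ (j == v)))
         (∨-assoc (j == u) (j == v) ((i == u) ∨ (i == v)))))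

-- A, B, C, D say whether i = u, i = v, j = u, j = v for an edge (i , j) and the edge (u , v).
incidences : ∀ A B C D → A ∧ B ≡ false → C ∧ D ≡ false → A ∧ C ≡ false → B ∧ D ≡ false →
  χ (not ((A ∧ D) ∨ (B ∧ C)) ∧ (A ∨ B ∨ C ∨ D)) + 2 * χ (A ∧ D) + 2 * χ (B ∧ C)
  ≡ χ A + χ B + χ C + χ D
incidences true  true  _     _     () _  _  _
incidences _     _     true  true  _  () _  _
incidences true  _     true  _     _  _  () _
incidences _     true  _     true  _  _  _  ()
incidences false false false false _  _  _  _ = refl
incidences true  false false false _  _  _  _ = refl
incidences false true  false false _  _  _  _ = refl
incidences false false true  false _  _  _  _ = refl
incidences false false false true  _  _  _  _ = refl
incidences true  false false true  _  _  _  _ = refl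
incidences false true  true  false _  _  _  _ = refl

module _ (G : Graph) {u v} (u<v : toℕ u < toℕ v) (uv : adj G u v ≡ true) where

  private
    X AD BC Iu Iv Ju Jv : Fin (n G) → Fin (n G) → ℕ
    X  i j = χ (adj G i j ∧ neighbouring (u , v) (i , j))
    AD i j = χ (adj G i j ∧ ((i == u) ∧ (j == v)))
    BC i j = χ (adj G i j ∧ ((i == v) ∧ (j == u)))
    Iu i j = χ (adj G i j ∧ (i == u))
    Iv i j = χ (adj G i j ∧ (i == v))
    Ju i j = χ (adj G i j ∧ (j == u))
    Jv i j = χ (adj G i j ∧ (j == v))

    crossed : ∀ {i j} → toℕ i < toℕ j → (i == v) ∧ (j == u) ≡ false
    crossed {i} {j} i<j with i ≟ v | j ≟ u
    ... | yes refl | yes refl = ⊥-elim (<-asym i<j u<v)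
    ... | yes _    | no _     = refl
    ... | no _     | _        = refl

  double-S₁ : 2 * length (S₁ G (u , v)) ≡ ∑² X
  double-S₁ = trans (cong (2 *_) (trans (count-edges G _) (trans (∑²-cong agree)
    (sym (count-edges G (neighbouring (u , v)))))))
    (count-edges-sym G (neighbouring (u , v)) (neighbouring-swap (u , v)))
    where
    agree : ∀ i j → upper (λ i j → χ (adj G i j ∧ (not (sameEdge (i , j) (u , v)) ∧
                                                    shareEndpoint (i , j) (u , v)))) i j
                  ≡ upper X i j
    agree i j with toℕ i <ᵇ toℕ j | <ᵇ-reflects-< (toℕ i) (toℕ j)
    ... | false | _       = refl
    ... | true  | ofʸ i<j rewrite crossed i<j =
      cong (λ b → χ (adj G i j ∧ (not b ∧ shareEndpoint (i , j) (u , v)))) (sym (∨-identityʳ _))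

  ∑²-incidences : ∑² X + 2 * ∑² AD + 2 * ∑² BC ≡ ∑² Iu + ∑² Iv + ∑² Ju + ∑² Jv
  ∑²-incidences = begin
    ∑² X + 2 * ∑² AD + 2 * ∑² BC
      ≡⟨ cong₂ (λ p q → ∑² X + p + q) (*-distribˡ-∑² 2 AD) (*-distribˡ-∑² 2 BC) ⟩
    ∑² X + ∑² (λ i j → 2 * AD i j) + ∑² (λ i j → 2 * BC i j)
      ≡⟨ cong (_+ ∑² (λ i j → 2 * BC i j)) (∑²-distrib-+ X (λ i j → 2 * AD i j)) ⟨
    ∑² (λ i j → X i j + 2 * AD i j) + ∑² (λ i j → 2 * BC i j)
      ≡⟨ ∑²-distrib-+ (λ i j → X i j + 2 * AD i j) (λ i j → 2 * BC i j) ⟨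
    ∑² (λ i j → X i j + 2 * AD i j + 2 * BC i j)
      ≡⟨ ∑²-cong pointwise ⟩
    ∑² (λ i j → Iu i j + Iv i j + Ju i j + Jv i j)
      ≡⟨ ∑²-distrib-+ (λ i j → Iu i j + Iv i j + Ju i j) Jv ⟩
    ∑² (λ i j → Iu i j + Iv i j + Ju i j) + ∑² Jv
      ≡⟨ cong (_+ ∑² Jv) (∑²-distrib-+ (λ i j → Iu i j + Iv i j) Ju) ⟩
    ∑² (λ i j → Iu i j + Iv i j) + ∑² Ju + ∑² Jv
      ≡⟨ cong (λ p → p + ∑² Ju + ∑² Jv) (∑²-distrib-+ Iu Iv) ⟩
    ∑² Iu + ∑² Iv + ∑² Ju + ∑² Jv ∎
    where
    open ≡-Reasoning
    pointwise : ∀ i j → X i j + 2 * AD i j + 2 * BC i j ≡ Iu i j + Iv i j + Ju i j + Jv i j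
    pointwise i j with adj G i j in ij
    ... | false = refl
    ... | true  = incidences (i == u) (i == v) (j == u) (j == v)
      (==-∧-==ˡ (adj⇒≢ G uv) i) (==-∧-==ˡ (adj⇒≢ G uv) j)
      (==-∧-==ʳ (adj⇒≢ G ij) u) (==-∧-==ʳ (adj⇒≢ G ij) v)

  S₁-length : length (S₁ G (u , v)) + 2 ≡ deg G u + deg G v
  S₁-length = *-cancelˡ-≡ _ _ 2 (begin
    2 * (s + 2)                                    ≡⟨ *-distribˡ-+ 2 s 2 ⟩
    2 * s + 4                                      ≡⟨ +-assoc (2 * s) 2 2 ⟨
    2 * s + 2 * 1 + 2 * 1                          ≡⟨ cong₂ (λ p q → 2 * s + 2 * χ p + 2 * χ q) uv vu ⟨
    2 * s + 2 * χ (adj G u v) + 2 * χ (adj G v u)  ≡⟨ cong₂ (λ p q → p + 2 * q + 2 * χ (adj G v u))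
                                                        double-S₁ (sym (∑²-entry G u v)) ⟩
    ∑² X + 2 * ∑² AD + 2 * χ (adj G v u)           ≡⟨ cong (λ q → ∑² X + 2 * ∑² AD + 2 * q) (∑²-entry G v u) ⟨
    ∑² X + 2 * ∑² AD + 2 * ∑² BC                   ≡⟨ ∑²-incidences ⟩
    ∑² Iu + ∑² Iv + ∑² Ju + ∑² Jv                  ≡⟨ cong₂ _+_ (cong₂ _+_ (cong₂ _+_ (∑²-row G u) (∑²-row G v))
                                                                         (∑²-column G u)) (∑²-column G v) ⟩
    deg G u + deg G v + deg G u + deg G v          ≡⟨ +-assoc (deg G u + deg G v) (deg G u) (deg G v) ⟩
    (deg G u + deg G v) + (deg G u + deg G v)      ≡⟨ cong (deg G u + deg G v +_) (+-identityʳ _) ⟨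
    2 * (deg G u + deg G v)                        ∎)
    where
    open ≡-Reasoning
    s = length (S₁ G (u , v))
    vu = trans (adj-sym G v u) uv

module _ (G : Graph) where

  S₁-length-∈ : ∀ {u v} → (u , v) ∈ edges G → length (S₁ G (u , v)) + 2 ≡ deg G u + deg G v
  S₁-length-∈ uv∈ = S₁-length G (proj₁ (∈-edges⁻ G uv∈)) (proj₂ (∈-edges⁻ G uv∈))

  minS₁-≤-∈ : ∀ {u v} → (u , v) ∈ edges G → minS₁ G + 2 ≤ deg G u + deg G v
  minS₁-≤-∈ uv∈ = subst (minS₁ G + 2 ≤_) (S₁-length-∈ uv∈)
    (+-monoˡ-≤ 2 (minList-map-≤ (λ e → length (S₁ G e)) uv∈))

  minS₁-≤ : ∀ {x y} → adj G x y ≡ true → minS₁ G + 2 ≤ deg G x + deg G y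
  minS₁-≤ {x} {y} xy with adj⇒∈-edges G xy
  ... | inj₁ xy∈ = minS₁-≤-∈ xy∈
  ... | inj₂ yx∈ = subst (minS₁ G + 2 ≤_) (+-comm (deg G y) (deg G x)) (minS₁-≤-∈ yx∈)

  module _ {r} (regular : ∀ v → deg G v ≡ r) where

    regular-handshake : 2 * ∣E∣ G ≡ ∣V∣ G * r
    regular-handshake = trans (sym (handshake G)) (trans (sum-cong-≗ {n G} regular) (∑-const (n G) r))

    regular-minS₁ : ∀ {x y} → adj G x y ≡ true → minS₁ G ≡ r + r ∸ 2
    regular-minS₁ xy = minList-map-const _ (r + r ∸ 2) (proj₂ (some-edge (adj⇒∈-edges G xy)))
      λ {(u , v)} uv∈ → trans (sym (m+n∸n≡m _ 2))
        (cong (_∸ 2) (trans (S₁-length-∈ uv∈) (cong₂ _+_ (regular u) (regular v))))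
      where
      some-edge : ∀ {x y} → (x , y) ∈ edges G ⊎ (y , x) ∈ edges G → ∃ λ e → e ∈ edges G
      some-edge (inj₁ e∈) = _ , e∈
      some-edge (inj₂ e∈) = _ , e∈

-- Degrees and excess

∷-injective : ∀ {m n} {x : Fin n} {xs : Fin m → Fin n} →
  (∀ i → xs i ≢ x) → Injective _≡_ _≡_ xs → Injective _≡_ _≡_ (x Vec.∷ xs)
∷-injective _   _   {zero}  {zero}  _  = refl
∷-injective x∉  _   {zero}  {suc j} x≡ = ⊥-elim (x∉ j (sym x≡))
∷-injective x∉  _   {suc i} {zero}  ≡x = ⊥-elim (x∉ i ≡x)
∷-injective _   inj {suc i} {suc j} eq = cong suc (inj eq)

[]-injective : ∀ {n} → Injective _≡_ _≡_ (Vec.[] {A = Fin n})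
[]-injective {x = ()}

split-half : ∀ {p q t} → p + q < t → 2 * p < t ⊎ 2 * q < t
split-half {p} {q} {t} p+q<t with 2 * p <? t
... | yes 2p<t = inj₁ 2p<t
... | no  2p≮t = inj₂ (+-cancelˡ-< t (2 * q) t (begin-strict
  t + 2 * q      ≤⟨ +-monoˡ-≤ (2 * q) (≮⇒≥ 2p≮t) ⟩
  2 * p + 2 * q  ≡⟨ *-distribˡ-+ 2 p q ⟨
  2 * (p + q)    <⟨ *-monoʳ-< 2 p+q<t ⟩
  2 * t          ≡⟨ cong (t +_) (+-identityʳ t) ⟩
  t + t          ∎))
  where open ≤-Reasoning

module _ (G : Graph) where

  neighbours-≤-deg : ∀ {m x} (ι : Fin m → Fin (n G)) → Injective _≡_ _≡_ ι →
    (∀ i → adj G x (ι i) ≡ true) → m ≤ deg G x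
  neighbours-≤-deg {m} {x} ι ι-inj x~ι = begin
    m                             ≡⟨ *-identityʳ m ⟨
    m * 1                         ≡⟨ ∑-const m 1 ⟨
    ∑[ i < m ] 1                  ≡⟨ sum-cong-≗ {m} (λ i → cong χ (x~ι i)) ⟨
    ∑[ i < m ] χ (adj G x (ι i))  ≤⟨ ∑-∘-injective-≤ ι ι-inj (χ ∘ adj G x) ⟩
    deg G x                       ∎
    where open ≤-Reasoning

  two-neighbours⇒2≤deg : ∀ {x y z} → adj G x y ≡ true → adj G x z ≡ true → y ≢ z → 2 ≤ deg G x
  two-neighbours⇒2≤deg {y = y} {z} xy xz y≢z =
    neighbours-≤-deg (y Vec.∷ z Vec.∷ Vec.[])
      (∷-injective (λ { zero → y≢z ∘ sym }) (∷-injective (λ ()) []-injective))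
      (λ { zero → xy ; (suc zero) → xz })

  -- Truncated subtraction is harmless: below, every vertex has a neighbour.
  excess : Fin (n G) → ℕ
  excess v = deg G v ∸ 1

module _ (G : Graph) (no-isolated : NoIsolatedVertices G) where

  private
    T : ℕ
    T = ∑[ v < n G ] excess G v

  deg≡1+excess : ∀ v → deg G v ≡ suc (excess G v)
  deg≡1+excess v = sym (m+[n∸m]≡n (neighbours-≤-deg G {1} (λ _ → proj₁ (no-isolated v))
    (λ { {zero} {zero} _ → refl }) (λ _ → proj₂ (no-isolated v))))

  handshake-excess : 2 * ∣E∣ G ≡ ∣V∣ G + T
  handshake-excess = begin
    2 * ∣E∣ G                      ≡⟨ handshake G ⟨
    ∑[ v < n G ] deg G v           ≡⟨ sum-cong-≗ {n G} deg≡1+excess ⟩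
    ∑[ v < n G ] (1 + excess G v)  ≡⟨ ∑-distrib-+ (λ _ → 1) (excess G) ⟩
    ∑[ v < n G ] 1 + T             ≡⟨ cong (_+ T) (trans (∑-const (n G) 1) (*-identityʳ (n G))) ⟩
    ∣V∣ G + T                      ∎
    where open ≡-Reasoning

  low-excess-edge-minS₁< : ∀ {x y} → adj G x y ≡ true → 2 * (excess G x + excess G y) < T →
    2 * minS₁ G + ∣V∣ G < 2 * ∣E∣ G
  low-excess-edge-minS₁< {x} {y} xy low = begin-strict
    2 * minS₁ G + ∣V∣ G                    ≤⟨ +-monoˡ-≤ (∣V∣ G) (*-monoʳ-≤ 2 minS₁≤) ⟩
    2 * (excess G x + excess G y) + ∣V∣ G  <⟨ +-monoˡ-< (∣V∣ G) low ⟩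
    T + ∣V∣ G                              ≡⟨ +-comm T (∣V∣ G) ⟩
    ∣V∣ G + T                              ≡⟨ handshake-excess ⟨
    2 * ∣E∣ G                              ∎
    where
    open ≤-Reasoning
    minS₁≤ : minS₁ G ≤ excess G x + excess G y
    minS₁≤ = +-cancelʳ-≤ 2 _ _ (subst (minS₁ G + 2 ≤_)
      (trans (cong₂ _+_ (deg≡1+excess x) (deg≡1+excess y))
             (trans (cong suc (+-suc (excess G x) (excess G y))) (+-comm 2 _)))
      (minS₁-≤ G xy))

  two-disjoint-edges-minS₁< : (v : Fin 5 → Fin (n G)) → Injective _≡_ _≡_ v →
    adj G (v 0F) (v 1F) ≡ true → adj G (v 2F) (v 3F) ≡ true → 2 ≤ deg G (v 4F) →
    2 * minS₁ G + ∣V∣ G < 2 * ∣E∣ G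
  two-disjoint-edges-minS₁< v v-inj v₀v₁ v₂v₃ 2≤deg₄ =
    [ low-excess-edge-minS₁< v₀v₁ , low-excess-edge-minS₁< v₂v₃ ]′
    (split-half {e 0F + e 1F} {e 2F + e 3F} (begin-strict
      (e 0F + e 1F) + (e 2F + e 3F)         <⟨ m<m+n _ (s≤s⁻¹ (subst (2 ≤_) (deg≡1+excess (v 4F)) 2≤deg₄)) ⟩
      (e 0F + e 1F) + (e 2F + e 3F) + e 4F  ≡⟨ solve 5 (λ a b c d f → a :+ b :+ (c :+ d) :+ f
                                                 := a :+ (b :+ (c :+ (d :+ (f :+ con 0)))))
                                                 refl (e 0F) (e 1F) (e 2F) (e 3F) (e 4F) ⟩
      ∑[ i < 5 ] e i                        ≤⟨ ∑-∘-injective-≤ v v-inj (excess G) ⟩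
      T                                     ∎))
    where
    open ≤-Reasoning
    e : Fin 5 → ℕ
    e i = excess G (v i)

  five-vertices-5≤∣E∣ : (v : Fin 5 → Fin (n G)) → Injective _≡_ _≡_ v →
    (∀ i → 2 ≤ deg G (v (suc i))) → 5 ≤ ∣E∣ G
  five-vertices-5≤∣E∣ v v-inj 2≤deg = *-cancelˡ-< 2 4 (∣E∣ G) (begin
    9                       ≤⟨ +-mono-≤ 1≤deg₀ (+-mono-≤ (2≤deg 0F) (+-mono-≤ (2≤deg 1F)
                                 (+-mono-≤ (2≤deg 2F) (+-mono-≤ (2≤deg 3F) z≤n)))) ⟩
    ∑[ i < 5 ] deg G (v i)  ≤⟨ ∑-∘-injective-≤ v v-inj (deg G) ⟩
    ∑[ u < n G ] deg G u    ≡⟨ handshake G ⟩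
    2 * ∣E∣ G               ∎)
    where
    open ≤-Reasoning
    1≤deg₀ : 1 ≤ deg G (v 0F)
    1≤deg₀ = subst (1 ≤_) (sym (deg≡1+excess (v 0F))) (s≤s z≤n)

record _↪_ (H G : Graph) : Set where
  field
    to        : Fin (n H) → Fin (n G)
    injective : Injective _≡_ _≡_ to
    adjacent  : ∀ i j → adj G (to i) (to j) ≡ adj H i j
open _↪_

infixr 9 _∘↪_

_∘↪_ : ∀ {H G K} → G ↪ K → H ↪ G → H ↪ K
f ∘↪ g = record
  { to        = to f ∘ to g
  ; injective = injective g ∘ injective f
  ; adjacent  = λ i j → trans (adjacent f (to g i) (to g j)) (adjacent g i j)
  }

↪-deg : ∀ {H G} (e : H ↪ G) i → deg H i ≤ deg G (to e i)
↪-deg {H} {G} e i = begin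
  deg H i                                   ≡⟨ sum-cong-≗ {n H} (λ j → cong χ (adjacent e i j)) ⟨
  ∑[ j < n H ] χ (adj G (to e i) (to e j))  ≤⟨ ∑-∘-injective-≤ (to e) (injective e) (χ ∘ adj G (to e i)) ⟩
  deg G (to e i)                            ∎
  where open ≤-Reasoning

↪-onto⇒≅ : ∀ {H G} (e : H ↪ G) → (∀ v → ∃ λ i → to e i ≡ v) → G ≅ H
↪-onto⇒≅ {H} {G} e onto =
  mk↔ₛ′ (proj₁ ∘ onto) (to e) (λ i → injective e (proj₂ (onto (to e i)))) (proj₂ ∘ onto) ,
  λ u v → trans (cong₂ (adj G) (sym (proj₂ (onto u))) (sym (proj₂ (onto v))))
                (adjacent e (proj₁ (onto u)) (proj₁ (onto v)))

≅-deg : ∀ {G H} (σ : G ≅ H) v → deg G v ≡ deg H (Inverse.to (proj₁ σ) v)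
≅-deg {G} {H} (σ , σ-adj) v = trans (sum-cong-≗ {n G} (λ u → cong χ (σ-adj v u)))
  (sym (∑-permute (χ ∘ adj H (Inverse.to σ v)) σ))

deg-K₂₂ : ∀ i → deg K₂₂ i ≡ 2
deg-K₂₂ 0F = refl
deg-K₂₂ 1F = refl
deg-K₂₂ 2F = refl
deg-K₂₂ 3F = refl

K₂₂↪-deg : ∀ {G} (e : K₂₂ ↪ G) i → 2 ≤ deg G (to e i)
K₂₂↪-deg {G} e i = subst (_≤ deg G (to e i)) (deg-K₂₂ i) (↪-deg e i)

≅K₂₂-sizes : ∀ {G} → G ≅ K₂₂ → ∣E∣ G ≡ 4 × 2 * minS₁ G + ∣V∣ G ≡ 2 * ∣E∣ G
≅K₂₂-sizes {G} σ = ∣E∣≡4 , trans (cong₂ (λ m v → 2 * m + v) minS₁≡2 ∣V∣≡4) (cong (2 *_) (sym ∣E∣≡4))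
  where
  open Inverse (proj₁ σ) using (from; strictlyInverseˡ)
  deg≡2 : ∀ v → deg G v ≡ 2
  deg≡2 v = trans (≅-deg {G} {K₂₂} σ v) (deg-K₂₂ (Inverse.to (proj₁ σ) v))
  ∣V∣≡4 : ∣V∣ G ≡ 4
  ∣V∣≡4 = ↔⇒≡ (proj₁ σ)
  ∣E∣≡4 : ∣E∣ G ≡ 4
  ∣E∣≡4 = *-cancelˡ-≡ _ _ 2 (trans (regular-handshake G deg≡2) (cong (_* 2) ∣V∣≡4))
  minS₁≡2 : minS₁ G ≡ 2
  minS₁≡2 = regular-minS₁ G deg≡2
    (trans (proj₂ σ (from 0F) (from 1F)) (cong₂ (adj K₂₂) (strictlyInverseˡ 0F) (strictlyInverseˡ 1F)))

rotate : K₂₂ ↪ K₂₂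
rotate = record
  { to        = ρ
  ; injective = λ {i} {j} → from-yes (all? λ i → all? λ j → (ρ i ≟ ρ j) →-dec (i ≟ j)) i j
  ; adjacent  = from-yes (all? λ i → all? λ j → adj K₂₂ (ρ i) (ρ j) Bool.≟ adj K₂₂ i j)
  }
  where
  ρ : Fin 4 → Fin 4
  ρ 0F = 1F
  ρ 1F = 2F
  ρ 2F = 3F
  ρ 3F = 0F

-- Cycles in bipartite graphs

Square : Graph → Set
Square G = ∃₂ λ a b → ∃₂ λ c d → a ≢ c × b ≢ d ×
  adj G a b ≡ true × adj G b c ≡ true × adj G c d ≡ true × adj G d a ≡ true

square? : ∀ G → Dec (Square G)
square? G = any? λ a → any? λ b → any? λ c → any? λ d → ¬? (a ≟ c) ×-dec ¬? (b ≟ d) ×-dec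
  adj G a b Bool.≟ true ×-dec adj G b c Bool.≟ true ×-dec adj G c d Bool.≟ true ×-dec adj G d a Bool.≟ true

record Path (G : Graph) (m : ℕ) : Set where
  field
    vertex    : Fin (suc m) → Fin (n G)
    injective : Injective _≡_ _≡_ vertex
    step      : ∀ i → adj G (vertex (inject₁ i)) (vertex (suc i)) ≡ true

inject₁²≢suc² : ∀ {m} (i : Fin m) → inject₁ (inject₁ i) ≢ suc (suc i)
inject₁²≢suc² zero    ()
inject₁²≢suc² (suc i) eq = inject₁²≢suc² i (suc-injective eq)

Path-inner-deg : ∀ {G m} (p : Path G (suc m)) i → 2 ≤ deg G (Path.vertex p (suc (inject₁ i)))
Path-inner-deg {G} p i = two-neighbours⇒2≤deg G (trans (adj-sym G _ _) (step (inject₁ i))) (step (suc i))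
  (inject₁²≢suc² i ∘ Path.injective p)
  where open Path p using (step)

cycle⇒path : ∀ {G} (c : Cycle G) → Path G (2 + Cycle.k c)
cycle⇒path c = record
  { vertex    = w ∘ inject₁
  ; injective = λ {i} {j} → distinct i j
  ; step      = step ∘ inject₁
  }
  where open Cycle c

data CycleShape (G : Graph) : Set where
  square : Square G → CycleShape G
  long   : ∀ {k} → Path G (5 + k) → CycleShape G

module _ {G : Graph} (bipartite : Bipartite G) where

  private
    colour = proj₁ bipartite
    proper = proj₂ bipartite

  colour-path₂ : ∀ {x y z} → adj G x y ≡ true → adj G y z ≡ true → colour x ≡ colour z
  colour-path₂ xy yz = trans (¬-not (proper _ _ xy))
    (trans (cong not (¬-not (proper _ _ yz))) (not-involutive _))

  path₂-nonadjacent : ∀ {x y z} → adj G x y ≡ true → adj G y z ≡ true → adj G x z ≡ false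
  path₂-nonadjacent {x} {z = z} xy yz with adj G x z in xz
  ... | true  = ⊥-elim (proper _ _ xz (colour-path₂ xy yz))
  ... | false = refl

  cycle-shape : Cycle G → CycleShape G
  cycle-shape record { k = 0 ; w = w ; closed = closed ; step = step } =
    ⊥-elim (proper _ _ (subst (λ x → adj G (w 2F) x ≡ true) closed (step 2F))
                       (sym (colour-path₂ (step 0F) (step 1F))))
  cycle-shape record { k = 1 ; w = w ; closed = closed ; step = step ; distinct = distinct } =
    square (w 0F , w 1F , w 2F , w 3F , (λ ()) ∘ distinct 0F 2F , (λ ()) ∘ distinct 1F 3F ,
            step 0F , step 1F , step 2F , subst (λ x → adj G (w 3F) x ≡ true) closed (step 3F))
  cycle-shape record { k = 2 ; w = w ; closed = closed ; step = step } =
    ⊥-elim (proper _ _ (subst (λ x → adj G (w 4F) x ≡ true) closed (step 4F))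
                       (sym (trans (colour-path₂ (step 0F) (step 1F)) (colour-path₂ (step 2F) (step 3F)))))
  cycle-shape c@record { k = suc (suc (suc _)) } = long (cycle⇒path c)

  square⇒K₂₂↪ : Square G → K₂₂ ↪ G
  square⇒K₂₂↪ (a , b , c , d , a≢c , b≢d , ab , bc , cd , da) = record
    { to        = v
    ; injective = ∷-injective (λ { 0F → a≢b ∘ sym ; 1F → a≢c ∘ sym ; 2F → d≢a })
                 (∷-injective (λ { 0F → b≢c ∘ sym ; 1F → b≢d ∘ sym })
                 (∷-injective (λ { 0F → c≢d ∘ sym })
                 (∷-injective (λ ()) []-injective)))
    ; adjacent  = table
    }
    where
    v : Fin 4 → Fin (n G)
    v = a Vec.∷ b Vec.∷ c Vec.∷ d Vec.∷ Vec.[]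
    ba = trans (adj-sym G b a) ab
    cb = trans (adj-sym G c b) bc
    dc = trans (adj-sym G d c) cd
    ad = trans (adj-sym G a d) da
    a≢b = adj⇒≢ G ab
    b≢c = adj⇒≢ G bc
    c≢d = adj⇒≢ G cd
    d≢a = adj⇒≢ G da
    table : ∀ i j → adj G (v i) (v j) ≡ adj K₂₂ i j
    table 0F 0F = irrefl G a
    table 0F 1F = ab
    table 0F 2F = path₂-nonadjacent ab bc
    table 0F 3F = ad
    table 1F 0F = ba
    table 1F 1F = irrefl G b
    table 1F 2F = bc
    table 1F 3F = path₂-nonadjacent bc cd
    table 2F 0F = path₂-nonadjacent cb ba
    table 2F 1F = cb
    table 2F 2F = irrefl G c
    table 2F 3F = cd
    table 3F 0F = da
    table 3F 1F = path₂-nonadjacent da ab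
    table 3F 2F = dc
    table 3F 3F = irrefl G d

module _ (G : Graph) (no-isolated : NoIsolatedVertices G) where

  module _ {k} (p : Path G (5 + k)) where
    open Path p using (vertex; step)

    private
      first-five : Fin 5 → Fin (n G)
      first-five i = vertex (i ↑ˡ suc k)

      first-five-injective : Injective _≡_ _≡_ first-five
      first-five-injective = ↑ˡ-injective (suc k) _ _ ∘ Path.injective p

    long-path-5≤∣E∣ : 5 ≤ ∣E∣ G
    long-path-5≤∣E∣ = five-vertices-5≤∣E∣ G no-isolated first-five first-five-injective λ where
      0F → Path-inner-deg p 0F
      1F → Path-inner-deg p 1F
      2F → Path-inner-deg p 2F
      3F → Path-inner-deg p 3F

    long-path-minS₁< : 2 * minS₁ G + ∣V∣ G < 2 * ∣E∣ G
    long-path-minS₁< = two-disjoint-edges-minS₁< G no-isolated first-five first-five-injective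
      (step 0F) (step 2F) (Path-inner-deg p 3F)

  K₂₂-neighbour-minS₁< : ∀ {w} (e : K₂₂ ↪ G) → (∀ i → to e i ≢ w) → adj G w (to e 0F) ≡ true →
    2 * minS₁ G + ∣V∣ G < 2 * ∣E∣ G
  K₂₂-neighbour-minS₁< {w} e w∉ w~ = two-disjoint-edges-minS₁< G no-isolated (w Vec.∷ to e)
    (∷-injective w∉ (injective e)) w~ (adjacent e 1F 2F) (K₂₂↪-deg e 3F)

  module _ (e : K₂₂ ↪ G) where

    K₂₂↪-onto-or-outside : G ≅ K₂₂ ⊎ ∃ λ w → ∀ i → to e i ≢ w
    K₂₂↪-onto-or-outside with all? (λ v → any? (λ i → to e i ≟ v))
    ... | yes onto = inj₁ (↪-onto⇒≅ e onto)
    ... | no ¬onto with ¬∀⟶∃¬ _ _ (λ v → any? (λ i → to e i ≟ v)) ¬onto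
    ...   | w , w∉ = inj₂ (w , λ i eq → w∉ (i , eq))

    outside-K₂₂-5≤∣E∣ : ∀ {w} → (∀ i → to e i ≢ w) → 5 ≤ ∣E∣ G
    outside-K₂₂-5≤∣E∣ w∉ = five-vertices-5≤∣E∣ G no-isolated (_ Vec.∷ to e)
      (∷-injective w∉ (injective e)) (K₂₂↪-deg e)

    -- A neighbour x of w either lies on the square, which is then rotated to put x at
    -- position 0, or w x is an edge disjoint from the edge between positions 0 and 1.
    outside-K₂₂-minS₁< : ∀ {w} → (∀ i → to e i ≢ w) → 2 * minS₁ G + ∣V∣ G < 2 * ∣E∣ G
    outside-K₂₂-minS₁< {w} w∉ with no-isolated w
    ... | x , wx with any? (λ i → to e i ≟ x)
    ... | yes (0F , refl) = K₂₂-neighbour-minS₁< e w∉ wx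
    ... | yes (1F , refl) = K₂₂-neighbour-minS₁< (e ∘↪ rotate) (w∉ ∘ to rotate) wx
    ... | yes (2F , refl) = K₂₂-neighbour-minS₁< (e ∘↪ rotate ∘↪ rotate) (w∉ ∘ to (rotate ∘↪ rotate)) wx
    ... | yes (3F , refl) = K₂₂-neighbour-minS₁< (e ∘↪ rotate ∘↪ rotate ∘↪ rotate)
                                                 (w∉ ∘ to (rotate ∘↪ rotate ∘↪ rotate)) wx
    ... | no x∉ = two-disjoint-edges-minS₁< G no-isolated (w Vec.∷ x Vec.∷ to e ∘ inject₁)
      (∷-injective (λ { 0F → adj⇒≢ G wx ∘ sym ; (suc i) → w∉ (inject₁ i) })
      (∷-injective (λ i eq → x∉ (inject₁ i , eq)) (inject₁-injective ∘ injective e)))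
      wx (adjacent e 0F 1F) (K₂₂↪-deg e 2F)

    K₂₂↪-few-edges : ∣E∣ G ≤ 4 → (G ≅ K₂₂) × (2 * minS₁ G + ∣V∣ G ≡ 2 * ∣E∣ G)
    K₂₂↪-few-edges ∣E∣≤4 with K₂₂↪-onto-or-outside
    ... | inj₁ σ        = σ , proj₂ (≅K₂₂-sizes {G} σ)
    ... | inj₂ (_ , w∉) = ⊥-elim (<⇒≱ (outside-K₂₂-5≤∣E∣ w∉) ∣E∣≤4)

    K₂₂↪-many-edges : 5 ≤ ∣E∣ G → 2 * minS₁ G + ∣V∣ G < 2 * ∣E∣ G
    K₂₂↪-many-edges 5≤∣E∣ with K₂₂↪-onto-or-outside
    ... | inj₁ σ        = ⊥-elim (<⇒≱ 5≤∣E∣ (≤-reflexive (proj₁ (≅K₂₂-sizes {G} σ))))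
    ... | inj₂ (_ , w∉) = outside-K₂₂-minS₁< w∉

lemma3p7 : (H : Graph) → Bipartite H → NoIsolatedVertices H → ¬ IsForest H →
    (∣E∣ H ≤ 4 → (H ≅ K₂₂) × (2 * minS₁ H + ∣V∣ H ≡ 2 * ∣E∣ H))
    × (5 ≤ ∣E∣ H → 2 * minS₁ H + ∣V∣ H < 2 * ∣E∣ H)
lemma3p7 H bipartite no-isolated ¬forest = small , large
  where
  -- ¬ IsForest H yields a cycle only under a double negation, so both parts are first
  -- reduced to decidable statements: the existence of a square, and the inequality itself.
  some-shape : ¬ ¬ CycleShape H
  some-shape ¬shape = ¬forest (¬shape ∘ cycle-shape bipartite)

  small : ∣E∣ H ≤ 4 → (H ≅ K₂₂) × (2 * minS₁ H + ∣V∣ H ≡ 2 * ∣E∣ H)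
  small ∣E∣≤4 = K₂₂↪-few-edges H no-isolated (square⇒K₂₂↪ bipartite four-cycle) ∣E∣≤4
    where
    four-cycle : Square H
    four-cycle = decidable-stable (square? H) λ ¬square → some-shape λ
      { (square s) → ¬square s
      ; (long p)   → <⇒≱ (long-path-5≤∣E∣ H no-isolated p) ∣E∣≤4
      }

  large : 5 ≤ ∣E∣ H → 2 * minS₁ H + ∣V∣ H < 2 * ∣E∣ H
  large 5≤∣E∣ = decidable-stable (_ <? _) λ ¬goal → some-shape λ
    { (square s) → ¬goal (K₂₂↪-many-edges H no-isolated (square⇒K₂₂↪ bipartite s) 5≤∣E∣)
    ; (long p)   → ¬goal (long-path-minS₁< H no-isolated p)
    }
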